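{- For all $n\ge0$ and $j=0,1,2$, \[ c_{3n+j}^2=\delta_{j,0}+(1-\delta_{j,0})c_{j-1}^2+\sum_{k=1}^n\left\{c_{3k+j-1}^2+2\sum_{i=0}^{3(k-1)+j}p_{3k+j-1-i}c_i^2\right\}. \]
   Context: The Narayana's cows numbers $c_n$ are defined by $c_n=\delta_{n,0}+c_{n-1}+c_{n-3}$ for $n\ge0$, $c_n=0$ for $n<0$. The Padovan numbers $p_n$ are defined by $p_n=\delta_{n,0}+p_{n-2}+p_{n-3}$ for $n\ge0$, $p_n=0$ for $n<0$. $\delta_{i,j}$ is $1$ if $i=j$ and $0$ otherwise; empty sums are $0$. -}

module Defs where

open import Data.Nat using (ℕ; zero; suc; _+_; _*_; _∸_)

-- Narayana's cows numbers: c_n = δ_{n,0} + c_{n-1} + c_{n-3}, c_n = 0 for n < 0.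
-- Unfolded: c_0 = 1, c_1 = 1, c_2 = 1, c_{n+3} = c_{n+2} + c_n.
c : ℕ → ℕ
c 0 = 1
c 1 = 1
c 2 = 1
c (suc (suc (suc n))) = c (suc (suc n)) + c n

-- Padovan numbers: p_n = δ_{n,0} + p_{n-2} + p_{n-3}, p_n = 0 for n < 0.
-- Unfolded: p_0 = 1, p_1 = 0, p_2 = 1, p_{n+3} = p_{n+1} + p_n.
p : ℕ → ℕ
p 0 = 1
p 1 = 0
p 2 = 1
p (suc (suc (suc n))) = p (suc n) + p n

-- Σ[ a ≤ i ≤ b ] f i as  sumFromTo a b f  (empty, i.e. 0, when b < a).
-- Implemented as sum over i = a, a+1, ..., a + (b + 1 - a) - 1.
sumCount : ℕ → ℕ → (ℕ → ℕ) → ℕ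
sumCount a zero f = 0
sumCount a (suc m) f = f a + sumCount (suc a) m f

sumFromTo : ℕ → ℕ → (ℕ → ℕ) → ℕ
sumFromTo a b f = sumCount a (suc b ∸ a) f

δ : ℕ → ℕ → ℕ
δ zero zero = 1
δ zero (suc _) = 0
δ (suc _) zero = 0
δ (suc i) (suc j) = δ i j

sq : ℕ → ℕ
sq x = x * x

-- Squaring c_{N+3} = c_{N+2} + c_N gives c_{N+3}² = c_N² + c_{N+2}² + 2 c_{N+2} c_N, and the
-- cross term is a Padovan convolution: c_{N+2} c_N = Σ_{i ≤ N} p_{N+2-i} c_i².  That identity
-- holds by induction in steps of three, because the convolution inherits the Padovan recurrence
-- p_{d+3} = p_{d+1} + p_d in its shift d.  Taking N = 3n + j and telescoping over n gives the
-- formula, whose initial term is c_j² for j ≤ 2.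
module Submission where

open import Defs
open import Data.Nat using (ℕ; zero; suc; _+_; _*_; _∸_; _≤_; s≤s)
open import Data.Nat.Properties using (+-suc; +-assoc; +-identityʳ; *-distribʳ-+; m+n∸n≡m)
open import Data.Nat.Tactic.RingSolver using (solve-∀)
open import Function using (_∘_)
open import Relation.Binary.PropositionalEquality
  using (_≡_; refl; sym; trans; cong; cong₂; module ≡-Reasoning)
open ≡-Reasoning

sumCount-cong : ∀ a m {f g : ℕ → ℕ} → (∀ i → f i ≡ g i) → sumCount a m f ≡ sumCount a m g
sumCount-cong a zero    f≗g = refl
sumCount-cong a (suc m) f≗g = cong₂ _+_ (f≗g a) (sumCount-cong (suc a) m f≗g)

sumCount-snoc : ∀ a m (f : ℕ → ℕ) → sumCount a (suc m) f ≡ sumCount a m f + f (a + m)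
sumCount-snoc a zero f = trans (+-identityʳ (f a)) (cong f (sym (+-identityʳ a)))
sumCount-snoc a (suc m) f = begin
  f a + sumCount (suc a) (suc m) f            ≡⟨ cong (f a +_) (sumCount-snoc (suc a) m f) ⟩
  f a + (sumCount (suc a) m f + f (suc a + m)) ≡⟨ sym (+-assoc (f a) _ _) ⟩
  f a + sumCount (suc a) m f + f (suc (a + m)) ≡⟨ cong (λ k → f a + sumCount (suc a) m f + f k) (sym (+-suc a m)) ⟩
  f a + sumCount (suc a) m f + f (a + suc m)   ∎

padovanConv : (ℕ → ℕ) → ℕ → ℕ → ℕ
padovanConv f d zero    = p d * f 0
padovanConv f d (suc N) = padovanConv f (suc d) N + p d * f (suc N)

sumFromTo-padovanConv : ∀ f d N →
  sumFromTo 0 N (λ i → p (d + N ∸ i) * f i) ≡ padovanConv f d N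
sumFromTo-padovanConv f d zero =
  trans (+-identityʳ _) (cong (λ k → p k * f 0) (+-identityʳ d))
sumFromTo-padovanConv f d (suc N) = begin
  sumCount 0 (suc (suc N)) term
    ≡⟨ sumCount-snoc 0 (suc N) term ⟩
  sumCount 0 (suc N) term + p (d + suc N ∸ suc N) * f (suc N)
    ≡⟨ cong₂ _+_ shifted (cong (λ k → p k * f (suc N)) (m+n∸n≡m d (suc N))) ⟩
  padovanConv f (suc d) N + p d * f (suc N) ∎
  where
  term : ℕ → ℕ
  term i = p (d + suc N ∸ i) * f i
  shifted : sumCount 0 (suc N) term ≡ padovanConv f (suc d) N
  shifted = trans (sumCount-cong 0 (suc N) (λ i → cong (λ k → p (k ∸ i) * f i) (+-suc d N)))
                  (sumFromTo-padovanConv f (suc d) N)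

padovanConv-recurrence : ∀ f N d →
  padovanConv f (3 + d) N ≡ padovanConv f (1 + d) N + padovanConv f d N
padovanConv-recurrence f zero d = *-distribʳ-+ (f 0) (p (1 + d)) (p d)
padovanConv-recurrence f (suc N) d = begin
  padovanConv f (4 + d) N + (p (1 + d) + p d) * f (suc N)
    ≡⟨ cong₂ _+_ (padovanConv-recurrence f N (suc d)) (*-distribʳ-+ (f (suc N)) (p (1 + d)) (p d)) ⟩
  (padovanConv f (2 + d) N + padovanConv f (1 + d) N) + (p (1 + d) * f (suc N) + p d * f (suc N))
    ≡⟨ interchange (padovanConv f (2 + d) N) (padovanConv f (1 + d) N) (p (1 + d) * f (suc N)) (p d * f (suc N)) ⟩
  padovanConv f (1 + d) (suc N) + padovanConv f d (suc N) ∎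
  where
  interchange : ∀ a b x y → (a + b) + (x + y) ≡ (a + x) + (b + y)
  interchange = solve-∀

c[2+N]*c[N]≡padovanConv : ∀ N → c (2 + N) * c N ≡ padovanConv (sq ∘ c) 2 N
c[2+N]*c[N]≡padovanConv 0 = refl
c[2+N]*c[N]≡padovanConv 1 = refl
c[2+N]*c[N]≡padovanConv 2 = refl
c[2+N]*c[N]≡padovanConv (suc (suc (suc N))) = begin
  (e + a + b + e) * (e + a)
    ≡⟨ expand a b e ⟩
  (e + a) * b + e * a + sq e + sq (e + a)
    ≡⟨ cong (λ s → s + sq e + sq (e + a))
            (cong₂ _+_ (c[2+N]*c[N]≡padovanConv (suc N)) (c[2+N]*c[N]≡padovanConv N)) ⟩
  (padovanConv (sq ∘ c) 3 N + 1 * sq b) + padovanConv (sq ∘ c) 2 N + sq e + sq (e + a)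
    ≡⟨ regroup (padovanConv (sq ∘ c) 3 N) (padovanConv (sq ∘ c) 2 N) (sq b) (sq e) (sq (e + a)) ⟩
  (padovanConv (sq ∘ c) 3 N + padovanConv (sq ∘ c) 2 N) + 1 * sq b + 1 * sq e + 1 * sq (e + a)
    ≡⟨ cong (λ s → s + 1 * sq b + 1 * sq e + 1 * sq (e + a)) (sym (padovanConv-recurrence (sq ∘ c) N 2)) ⟩
  padovanConv (sq ∘ c) 5 N + 1 * sq b + 1 * sq e + 1 * sq (e + a) ∎
  where
  a b e : ℕ
  a = c N
  b = c (1 + N)
  e = c (2 + N)
  expand : ∀ a b e → (e + a + b + e) * (e + a) ≡ (e + a) * b + e * a + e * e + (e + a) * (e + a)
  expand = solve-∀
  regroup : ∀ x y u v w → x + 1 * u + y + v + w ≡ (x + y) + 1 * u + 1 * v + 1 * w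
  regroup = solve-∀

sq[c[3+N]] : ∀ N → sq (c (3 + N)) ≡ sq (c N) + (sq (c (2 + N)) + 2 * padovanConv (sq ∘ c) 2 N)
sq[c[3+N]] N = begin
  (c (2 + N) + c N) * (c (2 + N) + c N)
    ≡⟨ square-sum (c N) (c (2 + N)) ⟩
  sq (c N) + (sq (c (2 + N)) + 2 * (c (2 + N) * c N))
    ≡⟨ cong (λ s → sq (c N) + (sq (c (2 + N)) + 2 * s)) (c[2+N]*c[N]≡padovanConv N) ⟩
  sq (c N) + (sq (c (2 + N)) + 2 * padovanConv (sq ∘ c) 2 N) ∎
  where
  square-sum : ∀ a e → (e + a) * (e + a) ≡ a * a + (e * e + 2 * (e * a))
  square-sum = solve-∀

mainTheorem16 : (n j : ℕ) → j ≤ 2 →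
    sq (c (3 * n + j)) ≡
    δ j 0 + (1 ∸ δ j 0) * sq (c (j ∸ 1))
    + sumFromTo 1 n (λ k →
    sq (c (3 * k + j ∸ 1))
    + 2 * sumFromTo 0 (3 * (k ∸ 1) + j) (λ i → p (3 * k + j ∸ 1 ∸ i) * sq (c i)))
mainTheorem16 zero 0 _ = refl
mainTheorem16 zero 1 _ = refl
mainTheorem16 zero 2 _ = refl
mainTheorem16 zero (suc (suc (suc j))) (s≤s (s≤s ()))
mainTheorem16 (suc n) j j≤2 = begin
  sq (c (3 * suc n + j))
    ≡⟨ cong (sq ∘ c) index ⟩
  sq (c (3 + m))
    ≡⟨ sq[c[3+N]] m ⟩
  sq (c m) + (sq (c (2 + m)) + 2 * padovanConv (sq ∘ c) 2 m)
    ≡⟨ cong₂ _+_ (mainTheorem16 n j j≤2) (sym (last-term (cong (_∸ 1) index))) ⟩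
  (initial + sumCount 1 n term) + term (suc n)
    ≡⟨ +-assoc initial _ _ ⟩
  initial + (sumCount 1 n term + term (suc n))
    ≡⟨ cong (initial +_) (sym (sumCount-snoc 1 n term)) ⟩
  initial + sumCount 1 (suc n) term ∎
  where
  m initial : ℕ
  m = 3 * n + j
  initial = δ j 0 + (1 ∸ δ j 0) * sq (c (j ∸ 1))
  term : ℕ → ℕ
  term k = sq (c (3 * k + j ∸ 1))
         + 2 * sumFromTo 0 (3 * (k ∸ 1) + j) (λ i → p (3 * k + j ∸ 1 ∸ i) * sq (c i))
  index : 3 * suc n + j ≡ 3 + m
  index = times3-shift n j
    where
    times3-shift : ∀ n j → 3 * (1 + n) + j ≡ 3 + (3 * n + j)
    times3-shift = solve-∀
  last-term : ∀ {e} → e ≡ 2 + m →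
    sq (c e) + 2 * sumFromTo 0 m (λ i → p (e ∸ i) * sq (c i))
      ≡ sq (c (2 + m)) + 2 * padovanConv (sq ∘ c) 2 m
  last-term refl = cong (λ s → sq (c (2 + m)) + 2 * s) (sumFromTo-padovanConv (sq ∘ c) 2 m)
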